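{- Let $k$ be a positive integer and let $G$ be a non-complete finite simple graph with $\kappa(G) = k$ and $\delta(G) \geq \lfloor \frac{3k}{2} \rfloor$. Then for every end $F$ of $G$ (a fragment to some minimum vertex cut $S$) and every minimum vertex cut $S_1$ of $G$, we have $F \cap S_1 = \emptyset$.
   Context: All graphs are finite, undirected and simple; $\kappa(G)$ is the vertex connectivity and $\delta(G)$ the minimum degree. A vertex cut of a connected graph $G$ is a set $S\subseteq V(G)$ such that $G-S$ has more than one component; a minimum vertex cut is one of smallest size (so of size $\kappa(G)$). For a minimum vertex cut $S$ of $G$, a fragment to $S$ is a union $F$ of components of $G-S$ such that $G - S - F$ is nonempty (so $N_G(F)=S$). An end of $G$ is a fragment of $G$ (to some minimum vertex cut) that does not contain any other fragment of $G$ (to any minimum vertex cut). -}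

module Defs where

open import Data.Nat using (ℕ; _≤_; _∸_)
open import Data.Bool using (Bool; true; false)
open import Data.Fin using (Fin)
open import Data.Fin.Subset using (Subset; _∈_; _∉_; _⊆_; ∁; Nonempty; ∣_∣)
open import Data.Vec using (tabulate)
open import Data.Product using (Σ; ∃; _×_; _,_)
open import Data.Sum using (_⊎_)
open import Relation.Nullary using (¬_)
open import Relation.Binary.PropositionalEquality using (_≡_; _≢_)

record Graph (n : ℕ) : Set where
  field
    adj     : Fin n → Fin n → Bool
    sym     : ∀ u v → adj u v ≡ adj v u
    irrefl  : ∀ v → adj v v ≡ false
open Graph public

module _ {n : ℕ} (G : Graph n) where

  N : Fin n → Subset n
  N v = tabulate (adj G v)

  deg : Fin n → ℕ
  deg v = ∣ N v ∣

  MinDegreeAtLeast : ℕ → Set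
  MinDegreeAtLeast d = ∀ v → d ≤ deg v

  IsComplete : Set
  IsComplete = ∀ u v → u ≢ v → adj G u v ≡ true

  NonComplete : Set
  NonComplete = ¬ IsComplete

  data Path (X : Subset n) : Fin n → Fin n → Set where
    here : ∀ {u} → u ∈ X → Path X u u
    step : ∀ {u v w} → Path X u v → adj G v w ≡ true → w ∈ X → Path X u w

  IsVertexCut : Subset n → Set
  IsVertexCut S = Σ (Fin n) λ u → Σ (Fin n) λ v →
    u ∈ ∁ S × v ∈ ∁ S × ¬ Path (∁ S) u v

  -- κ(G) = k  (convention κ(K_n) = n - 1; otherwise least size of a vertex cut)
  Connectivity : ℕ → Set
  Connectivity k =
    (IsComplete × k ≡ n ∸ 1) ⊎
    ((Σ (Subset n) λ S → IsVertexCut S × ∣ S ∣ ≡ k) ×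
     (∀ T → IsVertexCut T → k ≤ ∣ T ∣))

  IsMinVertexCut : Subset n → Set
  IsMinVertexCut S = IsVertexCut S × (∀ T → IsVertexCut T → ∣ S ∣ ≤ ∣ T ∣)

  -- F is a fragment to the minimum vertex cut S: a nonempty union of
  -- components of G - S (i.e. F ⊆ V∖S, F closed under adjacency in G - S)
  -- such that G - S - F is nonempty.
  IsFragmentTo : Subset n → Subset n → Set
  IsFragmentTo S F =
    IsMinVertexCut S × F ⊆ ∁ S × Nonempty F ×
    (∀ u v → u ∈ F → v ∈ ∁ S → adj G u v ≡ true → v ∈ F) ×
    (Σ (Fin n) λ v → v ∈ ∁ S × v ∉ F)

  IsFragment : Subset n → Set
  IsFragment F = Σ (Subset n) λ S → IsFragmentTo S F

  IsEnd : Subset n → Set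
  IsEnd F = IsFragment F × (∀ F′ → IsFragment F′ → F′ ⊆ F → F′ ≡ F)

-- Cross the end F, the inner side of the separation given by its cut S, with
-- a separation given by the minimum cut S₁, and count vertices over the nine
-- cells of the two separations.  Minimum degree ⌊3k/2⌋ gives every side more
-- than k/2 vertices, and connectivity k gives the neighbourhood of every
-- nonempty corner at least k vertices.  The neighbourhoods of two opposite
-- corners together fit into S and S₁, so if some side lay inside the other
-- cut, two sides would have at most k vertices together.  Hence some pair of
-- opposite corners is nonempty, and the corner inside F is a fragment; as F
-- is an end, that corner is all of F, which therefore misses S₁.
module Submission where

open import Defs
open import Data.Nat using (ℕ; _≤_; _*_; _/_)
open import Data.Fin.Subset using (Subset; Empty; _∩_)

open import Data.Nat using (zero; suc; _+_; _<_; _≤ᵇ_; z≤n; s≤s⁻¹)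
open import Data.Nat.Properties
open import Data.Nat.DivMod using (m*n/n≡m; /-monoˡ-≤)
open import Data.Nat.Tactic.RingSolver using (solve-∀)
open import Data.Bool as Bool using (Bool; true; false; _∧_; _∨_; not; T)
open import Data.Bool.Properties using (∧-comm)
open import Data.Unit using (tt)
open import Data.Fin using (Fin) renaming (zero to fzero; suc to fsuc)
open import Data.Fin.Properties using (any?)
open import Data.Fin.Subset using (_∈_; _∉_; _⊆_; _⊂_; ∁; _∪_; ⁅_⁆; Nonempty; ∣_∣)
open import Data.Fin.Subset.Properties
  using (_∈?_; _⊂?_; nonempty?; ∣p∣≤n; p⊂q⇒∣p∣<∣q∣; x∈⁅x⁆; x∈⁅y⁆⇒x≡y;
         x∈∁p⇒x∉p; x∉p⇒x∈∁p; p⊆p∪q; q⊆p∪q; x∈p∪q⁻; x∈p∩q⁻)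
open import Data.Vec using (lookup; tabulate)
open import Data.Vec.Properties
  using ([]=⇒lookup; lookup⇒[]=; lookup∘tabulate; tabulate∘lookup; tabulate-cong)
open import Data.List using (List; []; _∷_)
open import Data.Product using (Σ-syntax; ∃; _×_; _,_; proj₁; proj₂)
open import Data.Sum using (_⊎_; inj₁; inj₂)
open import Data.Empty using (⊥; ⊥-elim)
open import Function using (_∘_; id)
open import Relation.Unary using (Decidable)
open import Relation.Nullary using (¬_; Dec; yes; no; does)
open import Relation.Nullary.Decidable using (_×-dec_; dec-true)
open import Relation.Binary.PropositionalEquality as ≡
  using (_≡_; _≢_; refl; cong; cong₂; subst)
import Algebra.Properties.CommutativeMonoid.Sum as Sum
open Sum +-0-commutativeMonoid using (sum; ∑-distrib-+; sum-replicate-zero)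

[3*k]/2<m+k⇒k<m+m : ∀ {k m} → (3 * k) / 2 < m + k → k < m + m
[3*k]/2<m+k⇒k<m+m {k} {m} bound = ≰⇒> λ m+m≤k → <⇒≱ bound (begin
  m + k              ≡⟨ ≡.sym (m*n/n≡m (m + k) 2) ⟩
  (m + k) * 2 / 2    ≤⟨ /-monoˡ-≤ 2 (begin
    (m + k) * 2          ≡⟨ double m k ⟩
    (m + m) + (k + k)    ≤⟨ +-monoˡ-≤ (k + k) m+m≤k ⟩
    k + (k + k)          ≡⟨ triple k ⟩
    3 * k                ∎) ⟩
  (3 * k) / 2        ∎)
  where
  open ≤-Reasoning
  double : ∀ m k → (m + k) * 2 ≡ (m + m) + (k + k)
  double = solve-∀
  triple : ∀ k → k + (k + k) ≡ 3 * k
  triple = solve-∀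

t+a≤c+b⇒a≤b : ∀ {c k t a b} → c ≡ k → k ≤ t → t + a ≤ c + b → a ≤ b
t+a≤c+b⇒a≤b {a = a} refl k≤t bound = +-cancelˡ-≤ _ _ _ (≤-trans (+-monoˡ-≤ a k≤t) bound)

k<a+a⇒k<b+b⇒k<a+b : ∀ {k a b} → k < a + a → k < b + b → k < a + b
k<a+a⇒k<b+b⇒k<a+b {k} {a} {b} k<2a k<2b = ≰⇒> λ a+b≤k →
  <⇒≱ (+-mono-< k<2a k<2b) (≤-trans (≤-reflexive (regroup a b)) (+-mono-≤ a+b≤k a+b≤k))
  where
  regroup : ∀ a b → (a + a) + (b + b) ≡ (a + b) + (a + b)
  regroup = solve-∀

module _ {n : ℕ} {f : Fin n → Bool} {v : Fin n} where

  ∈-tabulate⁺ : f v ≡ true → v ∈ tabulate f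
  ∈-tabulate⁺ fv = lookup⇒[]= v (tabulate f) (≡.trans (lookup∘tabulate f v) fv)

  ∈-tabulate⁻ : v ∈ tabulate f → f v ≡ true
  ∈-tabulate⁻ v∈ = ≡.trans (≡.sym (lookup∘tabulate f v)) ([]=⇒lookup v∈)

  ∉-tabulate⁺ : f v ≡ false → v ∉ tabulate f
  ∉-tabulate⁺ fv v∈ with ≡.trans (≡.sym fv) (∈-tabulate⁻ v∈)
  ... | ()

  ∉-tabulate⁻ : v ∉ tabulate f → f v ≡ false
  ∉-tabulate⁻ v∉ with f v in fv
  ... | true  = ⊥-elim (v∉ (∈-tabulate⁺ fv))
  ... | false = refl

module _ {n : ℕ} {p : Subset n} {v : Fin n} where

  lookup-∉ : v ∉ p → lookup p v ≡ false
  lookup-∉ v∉ with lookup p v in pv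
  ... | true  = ⊥-elim (v∉ (lookup⇒[]= v p pv))
  ... | false = refl

  ∉-lookup : lookup p v ≡ false → v ∉ p
  ∉-lookup pv v∈ with ≡.trans (≡.sym pv) ([]=⇒lookup v∈)
  ... | ()

does-true⁻ : ∀ {A : Set} (a? : Dec A) → does a? ≡ true → A
does-true⁻ (yes a) _ = a

indicator : Bool → ℕ
indicator true  = 1
indicator false = 0

∣tabulate∣ : ∀ {n} (f : Fin n → Bool) → ∣ tabulate f ∣ ≡ sum (indicator ∘ f)
∣tabulate∣ {zero}  f = refl
∣tabulate∣ {suc n} f with f fzero
... | true  = cong suc (∣tabulate∣ (f ∘ fsuc))
... | false = ∣tabulate∣ (f ∘ fsuc)

∑-mono-≤ : ∀ {n} {f g : Fin n → ℕ} → (∀ v → f v ≤ g v) → sum f ≤ sum g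
∑-mono-≤ {zero}  f≤g = z≤n
∑-mono-≤ {suc n} f≤g = +-mono-≤ (f≤g fzero) (∑-mono-≤ (f≤g ∘ fsuc))

_∪ᶜ_ : ∀ {C : Set} → (C → Bool) → (C → Bool) → C → Bool
(χ ∪ᶜ ψ) c = χ c ∨ ψ c

-- A linear inequality between sizes of unions of cells is checked cell by
-- cell, on the multiplicities with which each cell is counted; cells known to
-- be empty may be ignored.
module Counting {n : ℕ} {C : Set} (cell : Fin n → C) where

  region : (C → Bool) → Subset n
  region χ = tabulate (λ v → χ (cell v))

  size : List (C → Bool) → ℕ
  size []               = 0
  size (χ ∷ [])         = ∣ region χ ∣
  size (χ ∷ χs@(_ ∷ _)) = ∣ region χ ∣ + size χs

  multiplicity : List (C → Bool) → C → ℕ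
  multiplicity []               c = 0
  multiplicity (χ ∷ [])         c = indicator (χ c)
  multiplicity (χ ∷ χs@(_ ∷ _)) c = indicator (χ c) + multiplicity χs c

  size≡∑ : ∀ χs → size χs ≡ sum (λ v → multiplicity χs (cell v))
  size≡∑ []               = ≡.sym (sum-replicate-zero n)
  size≡∑ (χ ∷ [])         = ∣tabulate∣ (λ v → χ (cell v))
  size≡∑ (χ ∷ χs@(_ ∷ _)) =
    ≡.trans (cong₂ _+_ (∣tabulate∣ (λ v → χ (cell v))) (size≡∑ χs))
            (≡.sym (∑-distrib-+ (λ v → indicator (χ (cell v))) (λ v → multiplicity χs (cell v))))

  size-≤-vertexwise : ∀ χs ψs → (∀ v → multiplicity χs (cell v) ≤ multiplicity ψs (cell v)) →
                      size χs ≤ size ψs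
  size-≤-vertexwise χs ψs ≤v = begin
    size χs                                ≡⟨ size≡∑ χs ⟩
    sum (λ v → multiplicity χs (cell v))   ≤⟨ ∑-mono-≤ ≤v ⟩
    sum (λ v → multiplicity ψs (cell v))   ≡⟨ ≡.sym (size≡∑ ψs) ⟩
    size ψs                                ∎
    where open ≤-Reasoning

  size-≤ : ∀ χs ψs → (∀ c → T (multiplicity χs c ≤ᵇ multiplicity ψs c)) → size χs ≤ size ψs
  size-≤ χs ψs check = size-≤-vertexwise χs ψs (λ v → ≤ᵇ⇒≤ _ _ (check (cell v)))

  size-≤-except : ∀ ε → Empty (region ε) → ∀ χs ψs →
    (∀ c → T (ε c ∨ (multiplicity χs c ≤ᵇ multiplicity ψs c))) → size χs ≤ size ψs
  size-≤-except ε empty χs ψs check = size-≤-vertexwise χs ψs λ v →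
    ≤ᵇ⇒≤ _ _ (subst (λ b → T (b ∨ _)) (∉-tabulate⁻ (λ v∈ → empty (v , v∈))) (check (cell v)))

  Empty-∪ᶜ : ∀ χ ψ → Empty (region χ) → Empty (region ψ) → Empty (region (χ ∪ᶜ ψ))
  Empty-∪ᶜ χ ψ eχ eψ (v , v∈) with χ (cell v) in χv | ∈-tabulate⁻ v∈
  ... | true  | _  = eχ (v , ∈-tabulate⁺ χv)
  ... | false | ψv = eψ (v , ∈-tabulate⁺ ψv)

data Part : Set where
  inner cut outer : Part

inner≢cut : ∀ {p} → p ≡ inner → p ≡ cut → ⊥
inner≢cut refl ()

mirror : Part → Part
mirror inner = outer
mirror cut   = cut
mirror outer = inner

mirror-involutive : ∀ p → mirror (mirror p) ≡ p
mirror-involutive inner = refl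
mirror-involutive cut   = refl
mirror-involutive outer = refl

isInner isCut isOuter : Part → Bool
isInner inner = true
isInner _     = false
isCut cut = true
isCut _   = false
isOuter outer = true
isOuter _     = false

isCut-mirror : ∀ p → isCut (mirror p) ≡ isCut p
isCut-mirror inner = refl
isCut-mirror cut   = refl
isCut-mirror outer = refl

inCorner : Part → Part → Bool
inCorner x y = isInner x ∧ isInner y

-- The neighbourhood of the corner (inner , inner).
inCornerCut : Part → Part → Bool
inCornerCut x y = (isCut x ∧ not (isOuter y)) ∨ (isInner x ∧ isCut y)

inCorner⁻ : ∀ x y → inCorner x y ≡ true → x ≡ inner × y ≡ inner
inCorner⁻ inner inner _ = refl , refl

inCorner⇒¬inCornerCut : ∀ x y → inCorner x y ≡ true → inCornerCut x y ≡ false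
inCorner⇒¬inCornerCut inner inner _ = refl

¬outer∧¬inCornerCut⇒inCorner :
  ∀ x y → x ≢ outer → y ≢ outer → inCornerCut x y ≡ false → inCorner x y ≡ true
¬outer∧¬inCornerCut⇒inCorner inner inner _  _  _  = refl
¬outer∧¬inCornerCut⇒inCorner inner cut   _  _  ()
¬outer∧¬inCornerCut⇒inCorner inner outer _  y≢ _  = ⊥-elim (y≢ refl)
¬outer∧¬inCornerCut⇒inCorner cut   inner _  _  ()
¬outer∧¬inCornerCut⇒inCorner cut   cut   _  _  ()
¬outer∧¬inCornerCut⇒inCorner cut   outer _  y≢ _  = ⊥-elim (y≢ refl)
¬outer∧¬inCornerCut⇒inCorner outer _     x≢ _  _  = ⊥-elim (x≢ refl)

classify : Bool → Bool → Part
classify true  _     = inner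
classify false true  = cut
classify false false = outer

classify-inner⁻ : ∀ a b → classify a b ≡ inner → a ≡ true
classify-inner⁻ true  _     _  = refl
classify-inner⁻ false true  ()
classify-inner⁻ false false ()

classify-outer⁻ : ∀ a b → classify a b ≡ outer → a ≡ false × b ≡ false
classify-outer⁻ false false _ = refl , refl

isCut-classify : ∀ a b → (a ≡ true → b ≡ false) → isCut (classify a b) ≡ b
isCut-classify true  _     disjoint = ≡.sym (disjoint refl)
isCut-classify false true  _        = refl
isCut-classify false false _        = refl

every : (Part → Bool) → Bool
every f = f inner ∧ f cut ∧ f outer

T-∧⁻ : ∀ x {y} → T (x ∧ y) → T x × T y
T-∧⁻ true check = tt , check

every-sound : ∀ f → T (every f) → ∀ p → T (f p)
every-sound f check inner = proj₁ (T-∧⁻ (f inner) check)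
every-sound f check cut   = proj₁ (T-∧⁻ (f cut) (proj₂ (T-∧⁻ (f inner) check)))
every-sound f check outer = proj₂ (T-∧⁻ (f cut) (proj₂ (T-∧⁻ (f inner) check)))

every² : (Part × Part → Bool) → Bool
every² f = every (λ x → every (λ y → f (x , y)))

every²-sound : ∀ f → T (every² f) → ∀ c → T (f c)
every²-sound f check (x , y) =
  every-sound (λ y → f (x , y)) (every-sound (λ x → every (λ y → f (x , y))) check x) y

-- Sets of cells of a pair (P , Q) of separations; for instance
-- cornerAt mirror id is the corner of (P ᵒᵖ , Q).
Cells : Set
Cells = Part × Part → Bool

onP onQ : (Part → Bool) → Cells
onP f (x , _) = f x
onQ f (_ , y) = f y

cornerAt cornerCutAt : (Part → Part) → (Part → Part) → Cells
cornerAt    f g (x , y) = inCorner (f x) (g y)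
cornerCutAt f g (x , y) = inCornerCut (f x) (g y)

module Separations {n : ℕ} (G : Graph n) where

  -- C is a union of components of G − T.
  Closed : Subset n → Subset n → Set
  Closed T C = ∀ u v → u ∈ C → v ∈ ∁ T → adj G u v ≡ true → v ∈ C

  path-end : ∀ {X u v} → Path G X u v → v ∈ X
  path-end (here v∈)     = v∈
  path-end (step _ _ v∈) = v∈

  path-preserves : ∀ {T C u v} → Closed T C → Path G (∁ T) u v → u ∈ C → v ∈ C
  path-preserves closed (here _)       u∈ = u∈
  path-preserves closed (step p uv v∈) u∈ = closed _ _ (path-preserves closed p u∈) v∈ uv

  record Component (T : Subset n) (u : Fin n) : Set where
    field
      members : Subset n
      root    : u ∈ members
      reach   : ∀ {v} → v ∈ members → Path G (∁ T) u v
      closed  : Closed T members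

  module Reachability (T : Subset n) (u : Fin n) where

    Reached : Subset n → Set
    Reached R = u ∈ R × (∀ {v} → v ∈ R → Path G (∁ T) u v)

    Joins : Subset n → Fin n → Set
    Joins R z = z ∈ ∁ T × ∃ λ w → w ∈ R × adj G w z ≡ true

    joins? : ∀ R → Decidable (Joins R)
    joins? R z = z ∈? ∁ T ×-dec any? (λ w → w ∈? R ×-dec adj G w z Bool.≟ true)

    grow : Subset n → Subset n
    grow R = R ∪ tabulate (λ z → does (joins? R z))

    grow-reached : ∀ {R} → Reached R → Reached (grow R)
    grow-reached {R} (u∈ , paths) = p⊆p∪q _ u∈ , λ v∈ → extend (x∈p∪q⁻ R _ v∈)
      where
      extend : ∀ {v} → v ∈ R ⊎ v ∈ tabulate (λ z → does (joins? R z)) → Path G (∁ T) u v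
      extend (inj₁ v∈R) = paths v∈R
      extend {v} (inj₂ v∈J) with does-true⁻ (joins? R v) (∈-tabulate⁻ v∈J)
      ... | v∉T , w , w∈R , wv = step (paths w∈R) wv v∉T

    stable-closed : ∀ R → ¬ (R ⊂ grow R) → Closed T R
    stable-closed R R⊄ w z w∈R z∉T wz with z ∈? R
    ... | yes z∈R = z∈R
    ... | no  z∉R = ⊥-elim (R⊄ (p⊆p∪q _ , z , z∈grow , z∉R))
      where
      z∈grow = q⊆p∪q R _ (∈-tabulate⁺ (dec-true (joins? R z) (z∉T , w , w∈R , wz)))

    saturate : ∀ fuel R → Reached R → n < ∣ R ∣ + fuel → Component T u
    saturate zero R _ n<∣R∣ = ⊥-elim (<⇒≱ (subst (n <_) (+-identityʳ ∣ R ∣) n<∣R∣) (∣p∣≤n R))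
    saturate (suc fuel) R reached@(u∈R , paths) bound with R ⊂? grow R
    ... | no  R⊄ = record { members = R ; root = u∈R ; reach = paths ; closed = stable-closed R R⊄ }
    ... | yes R⊂ = saturate fuel (grow R) (grow-reached reached)
      (≤-<-trans (s≤s⁻¹ (subst (n <_) (+-suc ∣ R ∣ fuel) bound)) (+-monoˡ-< fuel (p⊂q⇒∣p∣<∣q∣ R⊂)))

  component : ∀ T u → u ∈ ∁ T → Component T u
  component T u u∉T = saturate (suc n) ⁅ u ⁆ (x∈⁅x⁆ u , singleton-path) (m≤n+m (suc n) ∣ ⁅ u ⁆ ∣)
    where
    open Reachability T u
    singleton-path : ∀ {v} → v ∈ ⁅ u ⁆ → Path G (∁ T) u v
    singleton-path v∈ with x∈⁅y⁆⇒x≡y u v∈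
    ... | refl = here u∉T

  minimum-cut-size : ∀ {k S₀ T} → IsVertexCut G S₀ → ∣ S₀ ∣ ≡ k →
    (∀ T → IsVertexCut G T → k ≤ ∣ T ∣) → IsMinVertexCut G T → ∣ T ∣ ≡ k
  minimum-cut-size S₀-cut ∣S₀∣≡k k≤cut (T-cut , T-min) =
    ≤-antisym (≤-trans (T-min _ S₀-cut) (≤-reflexive ∣S₀∣≡k)) (k≤cut _ T-cut)

  record Separation (k : ℕ) : Set where
    field
      part           : Fin n → Part
      separated      : ∀ {u v} → adj G u v ≡ true → part u ≡ inner → part v ≢ outer
      inner-occupied : ∃ λ v → part v ≡ inner
      outer-occupied : ∃ λ v → part v ≡ outer
      cut-size       : ∣ tabulate (λ v → isCut (part v)) ∣ ≡ k

  open Separation public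

  parts : Subset n → Subset n → Fin n → Part
  parts X S v = classify (lookup X v) (lookup S v)

  parts-inner⁻ : ∀ {X S v} → parts X S v ≡ inner → v ∈ X
  parts-inner⁻ {X} {S} {v} v-inner = lookup⇒[]= v X (classify-inner⁻ _ _ v-inner)

  parts-cut⁺ : ∀ {X S v} → X ⊆ ∁ S → v ∈ S → parts X S v ≡ cut
  parts-cut⁺ {X} {S} {v} X⊆∁S v∈S
    rewrite lookup-∉ {p = X} (λ v∈X → x∈∁p⇒x∉p (X⊆∁S v∈X) v∈S) | []=⇒lookup v∈S = refl

  module _ {k : ℕ} where

    separation : (X S : Subset n) → X ⊆ ∁ S → Closed S X → Nonempty X →
                 (∃ λ v → v ∈ ∁ S × v ∉ X) → ∣ S ∣ ≡ k → Separation k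
    part (separation X S _ _ _ _ _) = parts X S
    separated (separation X S _ closed _ _ _) {u} {v} uv u-inner v-outer =
      let Xv , Sv = classify-outer⁻ (lookup X v) (lookup S v) v-outer in
      ∉-lookup Xv (closed u v (parts-inner⁻ {S = S} u-inner) (x∉p⇒x∈∁p (∉-lookup Sv)) uv)
    inner-occupied (separation X S _ _ (v , v∈X) _ _) =
      v , cong (λ a → classify a (lookup S v)) ([]=⇒lookup v∈X)
    outer-occupied (separation X S _ _ _ (v , v∈∁S , v∉X) _) =
      v , cong₂ classify (lookup-∉ v∉X) (lookup-∉ (x∈∁p⇒x∉p v∈∁S))
    cut-size (separation X S X⊆∁S _ _ _ ∣S∣≡k) = ≡.trans
      (cong ∣_∣ (≡.trans (tabulate-cong λ v → isCut-classify _ _ (disjoint v)) (tabulate∘lookup S)))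
      ∣S∣≡k
      where
      disjoint : ∀ v → lookup X v ≡ true → lookup S v ≡ false
      disjoint v Xv = lookup-∉ (x∈∁p⇒x∉p (X⊆∁S (lookup⇒[]= v X Xv)))

    fragment-separation : ∀ {S F} → IsFragmentTo G S F → ∣ S ∣ ≡ k →
      Σ[ P ∈ Separation k ] (∀ {v} → part P v ≡ inner → v ∈ F)
    fragment-separation {S} {F} (_ , F⊆∁S , F-nonempty , F-closed , F-outside) ∣S∣≡k =
      separation F S F⊆∁S F-closed F-nonempty F-outside ∣S∣≡k , parts-inner⁻ {S = S}

    cut-separation : ∀ {S} → IsVertexCut G S → ∣ S ∣ ≡ k →
      Σ[ Q ∈ Separation k ] (∀ {v} → v ∈ S → part Q v ≡ cut)
    cut-separation {S} (u , w , u∉S , w∉S , no-path) ∣S∣≡k =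
      separation members S members⊆∁S closed (u , root) (w , w∉S , λ w∈ → no-path (reach w∈)) ∣S∣≡k ,
      parts-cut⁺ members⊆∁S
      where
      open Component (component S u u∉S)
      members⊆∁S : members ⊆ ∁ S
      members⊆∁S v∈ = path-end (reach v∈)

    _ᵒᵖ : Separation k → Separation k
    part (P ᵒᵖ) v = mirror (part P v)
    separated (P ᵒᵖ) {u} {v} uv u-inner v-outer =
      separated P (≡.trans (sym G v u) uv) (mirror-outer v-outer) (mirror-inner u-inner)
      where
      mirror-inner : ∀ {p} → mirror p ≡ inner → p ≡ outer
      mirror-inner {outer} _ = refl
      mirror-outer : ∀ {p} → mirror p ≡ outer → p ≡ inner
      mirror-outer {inner} _ = refl
    inner-occupied (P ᵒᵖ) with outer-occupied P
    ... | v , v-outer = v , cong mirror v-outer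
    outer-occupied (P ᵒᵖ) with inner-occupied P
    ... | v , v-inner = v , cong mirror v-inner
    cut-size (P ᵒᵖ) = ≡.trans (cong ∣_∣ (tabulate-cong (isCut-mirror ∘ part P))) (cut-size P)

    inners cuts : Separation k → Subset n
    inners P = tabulate (λ v → isInner (part P v))
    cuts   P = tabulate (λ v → isCut (part P v))

    corner cornerCut : Separation k → Separation k → Subset n
    corner    P Q = tabulate (λ v → inCorner (part P v) (part Q v))
    cornerCut P Q = tabulate (λ v → inCornerCut (part P v) (part Q v))

    ∈-corner⁻ : ∀ (P Q : Separation k) {v} → v ∈ corner P Q → part P v ≡ inner × part Q v ≡ inner
    ∈-corner⁻ P Q {v} v∈ = inCorner⁻ (part P v) (part Q v) (∈-tabulate⁻ v∈)

    corner-swap : ∀ (P Q : Separation k) → Empty (corner P Q) → Empty (corner Q P)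
    corner-swap P Q empty (v , v∈) =
      empty (v , ∈-tabulate⁺ (≡.trans (∧-comm (isInner (part P v)) _) (∈-tabulate⁻ v∈)))

    corner-mirror² : ∀ (P Q : Separation k) → Nonempty (corner P Q) → Nonempty (corner P (Q ᵒᵖ ᵒᵖ))
    corner-mirror² P Q (v , v∈) = v , ∈-tabulate⁺
      (subst (λ y → inCorner (part P v) y ≡ true) (≡.sym (mirror-involutive (part Q v))) (∈-tabulate⁻ v∈))

    corner-closed : ∀ (P Q : Separation k) → Closed (cornerCut P Q) (corner P Q)
    corner-closed P Q u z u∈ z∉ uz =
      let u-innerP , u-innerQ = ∈-corner⁻ P Q u∈ in
      ∈-tabulate⁺ (¬outer∧¬inCornerCut⇒inCorner (part P z) (part Q z)
        (separated P uz u-innerP) (separated Q uz u-innerQ) (∉-tabulate⁻ (x∈∁p⇒x∉p z∉)))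

    corner⊆∁cornerCut : ∀ (P Q : Separation k) → corner P Q ⊆ ∁ (cornerCut P Q)
    corner⊆∁cornerCut P Q {v} v∈ =
      x∉p⇒x∈∁p (∉-tabulate⁺ (inCorner⇒¬inCornerCut (part P v) (part Q v) (∈-tabulate⁻ v∈)))

    outer∉cornerCut : ∀ (P Q : Separation k) {v} → part P v ≡ outer → v ∈ ∁ (cornerCut P Q)
    outer∉cornerCut P Q {v} v-outer =
      x∉p⇒x∈∁p (∉-tabulate⁺ (subst (λ x → inCornerCut x (part Q v) ≡ false) (≡.sym v-outer) refl))

    outer∉corner : ∀ (P Q : Separation k) {v} → part P v ≡ outer → v ∉ corner P Q
    outer∉corner P Q v-outer v∈ with ≡.trans (≡.sym v-outer) (proj₁ (∈-corner⁻ P Q v∈))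
    ... | ()

    cornerCut-isVertexCut : ∀ (P Q : Separation k) → Nonempty (corner P Q) →
                            IsVertexCut G (cornerCut P Q)
    cornerCut-isVertexCut P Q (w , w∈) =
      w , z , corner⊆∁cornerCut P Q w∈ , outer∉cornerCut P Q z-outer ,
      λ path → outer∉corner P Q z-outer (path-preserves (corner-closed P Q) path w∈)
      where
      z = proj₁ (outer-occupied P)
      z-outer = proj₂ (outer-occupied P)

    end⊆corner : ∀ {F T} (P Q : Separation k) → IsEnd G F → (∀ {v} → part P v ≡ inner → v ∈ F) →
                 IsFragmentTo G T (corner P Q) → F ⊆ corner P Q
    end⊆corner P Q (_ , minimal) inner⊆F fragment {x} x∈F =
      subst (x ∈_) (≡.sym (minimal _ (_ , fragment) (λ v∈ → inner⊆F (proj₁ (∈-corner⁻ P Q v∈))))) x∈F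

  module Crossing {k : ℕ}
    (k≤cut : ∀ T → IsVertexCut G T → k ≤ ∣ T ∣)
    (δ≥ : MinDegreeAtLeast G ((3 * k) / 2)) where

    cells : Separation k → Separation k → Fin n → Part × Part
    cells P Q v = part P v , part Q v

    k≤cornerCut : ∀ (P Q : Separation k) → Nonempty (corner P Q) → k ≤ ∣ cornerCut P Q ∣
    k≤cornerCut P Q nonempty = k≤cut _ (cornerCut-isVertexCut P Q nonempty)

    corner-fragment : ∀ (P Q : Separation k) → Nonempty (corner P Q) → ∣ cornerCut P Q ∣ ≤ k →
                      IsFragmentTo G (cornerCut P Q) (corner P Q)
    corner-fragment P Q nonempty small =
      (cornerCut-isVertexCut P Q nonempty , λ T T-cut → ≤-trans small (k≤cut T T-cut)) ,
      corner⊆∁cornerCut P Q , nonempty , corner-closed P Q ,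
      (z , outer∉cornerCut P Q z-outer , outer∉corner P Q z-outer)
      where
      z = proj₁ (outer-occupied P)
      z-outer = proj₂ (outer-occupied P)

    -- The neighbourhoods of two opposite corners have at most ∣ S ∣ + ∣ S′ ∣
    -- vertices together.
    cornerCut-≤ : ∀ (P Q : Separation k) → Nonempty (corner (P ᵒᵖ) (Q ᵒᵖ)) → ∣ cornerCut P Q ∣ ≤ k
    cornerCut-≤ P Q opposite = ≤-trans
      (t+a≤c+b⇒a≤b (cut-size Q) (k≤cornerCut (P ᵒᵖ) (Q ᵒᵖ) opposite)
        (size-≤ (cornerCutAt mirror mirror ∷ cornerCutAt id id ∷ [])
                (onQ isCut ∷ onP isCut ∷ [])
                (every²-sound _ tt)))
      (≤-reflexive (cut-size P))
      where open Counting (cells P Q)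

    diagonal-fragment : ∀ (P Q : Separation k) → Nonempty (corner P Q) →
      Nonempty (corner (P ᵒᵖ) (Q ᵒᵖ)) → IsFragmentTo G (cornerCut P Q) (corner P Q)
    diagonal-fragment P Q nonempty opposite = corner-fragment P Q nonempty (cornerCut-≤ P Q opposite)

    -- Neighbours of an inner vertex are inner or in the cut.
    inner-large : ∀ (P : Separation k) → k < ∣ inners P ∣ + ∣ inners P ∣
    inner-large P = [3*k]/2<m+k⇒k<m+m (begin-strict
      (3 * k) / 2                 ≤⟨ δ≥ w ⟩
      deg G w                     <⟨ p⊂q⇒∣p∣<∣q∣ (N⊆ , w , ∈-tabulate⁺ w-near , w∉N) ⟩
      ∣ region near ∣             ≤⟨ size-≤ (near ∷ []) (isInner ∷ isCut ∷ []) (every-sound _ tt) ⟩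
      ∣ inners P ∣ + ∣ cuts P ∣   ≡⟨ cong (∣ inners P ∣ +_) (cut-size P) ⟩
      ∣ inners P ∣ + k            ∎)
      where
      open ≤-Reasoning
      open Counting (part P)
      near : Part → Bool
      near x = isInner x ∨ isCut x
      w = proj₁ (inner-occupied P)
      w-inner = proj₂ (inner-occupied P)
      w-near : near (part P w) ≡ true
      w-near rewrite w-inner = refl
      ¬outer⇒near : ∀ x → x ≢ outer → near x ≡ true
      ¬outer⇒near inner _  = refl
      ¬outer⇒near cut   _  = refl
      ¬outer⇒near outer x≢ = ⊥-elim (x≢ refl)
      N⊆ : N G w ⊆ region near
      N⊆ z∈ = ∈-tabulate⁺ (¬outer⇒near _ (separated P (∈-tabulate⁻ z∈) w-inner))
      w∉N : w ∉ N G w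
      w∉N = ∉-tabulate⁺ (irrefl G w)

    sides-large : ∀ (A B : Separation k) → k < ∣ inners A ∣ + ∣ inners B ∣
    sides-large A B =
      k<a+a⇒k<b+b⇒k<a+b {a = ∣ inners A ∣} {b = ∣ inners B ∣} (inner-large A) (inner-large B)

    -- Whichever of the two corners on the outer side of P are nonempty, two
    -- sides together have at most k vertices.
    inner-not-in-cut : ∀ (P Q : Separation k) → Empty (corner P Q) → Empty (corner P (Q ᵒᵖ)) → ⊥
    inner-not-in-cut P Q e₁ e₂ =
      cases (nonempty? (corner (P ᵒᵖ) Q)) (nonempty? (corner (P ᵒᵖ) (Q ᵒᵖ)))
      where
      open Counting (cells P Q)
      ε : Cells
      ε = cornerAt id id ∪ᶜ cornerAt id mirror
      ε-empty : Empty (region ε)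
      ε-empty = Empty-∪ᶜ (cornerAt id id) (cornerAt id mirror) e₁ e₂
      cases : Dec (Nonempty (corner (P ᵒᵖ) Q)) → Dec (Nonempty (corner (P ᵒᵖ) (Q ᵒᵖ))) → ⊥
      cases (yes c₃) (yes c₄) = <⇒≱ (sides-large P P)
        (≤-trans (t+a≤c+b⇒a≤b (cut-size Q) (k≤cornerCut (P ᵒᵖ) Q c₃)
                 (t+a≤c+b⇒a≤b (cut-size Q) (k≤cornerCut (P ᵒᵖ) (Q ᵒᵖ) c₄)
                   (size-≤-except ε ε-empty
                     (cornerCutAt mirror mirror ∷ cornerCutAt mirror id ∷ onP isInner ∷ onP isInner ∷ [])
                     (onQ isCut ∷ onQ isCut ∷ onP isCut ∷ [])
                     (every²-sound _ tt))))
                 (≤-reflexive (cut-size P)))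
      cases (yes c₃) (no e₄) = <⇒≱ (sides-large P (Q ᵒᵖ))
        (≤-trans (t+a≤c+b⇒a≤b (cut-size Q) (k≤cornerCut (P ᵒᵖ) Q c₃)
                   (size-≤-except (ε ∪ᶜ cornerAt mirror mirror)
                     (Empty-∪ᶜ ε (cornerAt mirror mirror) ε-empty e₄)
                     (cornerCutAt mirror id ∷ onP isInner ∷ onQ (isInner ∘ mirror) ∷ [])
                     (onQ isCut ∷ onP isCut ∷ [])
                     (every²-sound _ tt)))
                 (≤-reflexive (cut-size P)))
      cases (no e₃) (yes c₄) = <⇒≱ (sides-large P Q)
        (≤-trans (t+a≤c+b⇒a≤b (cut-size Q) (k≤cornerCut (P ᵒᵖ) (Q ᵒᵖ) c₄)
                   (size-≤-except (ε ∪ᶜ cornerAt mirror id)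
                     (Empty-∪ᶜ ε (cornerAt mirror id) ε-empty e₃)
                     (cornerCutAt mirror mirror ∷ onP isInner ∷ onQ isInner ∷ [])
                     (onQ isCut ∷ onP isCut ∷ [])
                     (every²-sound _ tt)))
                 (≤-reflexive (cut-size P)))
      cases (no e₃) (no e₄) = <⇒≱ (sides-large P (P ᵒᵖ))
        (≤-trans (size-≤-except (ε ∪ᶜ (cornerAt mirror id ∪ᶜ cornerAt mirror mirror))
                   (Empty-∪ᶜ ε (cornerAt mirror id ∪ᶜ cornerAt mirror mirror) ε-empty
                     (Empty-∪ᶜ (cornerAt mirror id) (cornerAt mirror mirror) e₃ e₄))
                   (onP isInner ∷ onP (isInner ∘ mirror) ∷ [])
                   (onQ isCut ∷ [])
                   (every²-sound _ tt))
                 (≤-reflexive (cut-size Q)))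

    -- If each diagonal had an empty corner, two empty corners would share a
    -- side, which then lies in the other cut.
    crossing : ∀ (P Q : Separation k) →
      (Nonempty (corner P Q) × Nonempty (corner (P ᵒᵖ) (Q ᵒᵖ))) ⊎
      (Nonempty (corner P (Q ᵒᵖ)) × Nonempty (corner (P ᵒᵖ) Q))
    crossing P Q with nonempty? (corner P Q)        | nonempty? (corner (P ᵒᵖ) (Q ᵒᵖ))
                    | nonempty? (corner P (Q ᵒᵖ)) | nonempty? (corner (P ᵒᵖ) Q)
    ... | yes c₁ | yes c₂ | _      | _      = inj₁ (c₁ , c₂)
    ... | _      | _      | yes c₃ | yes c₄ = inj₂ (c₃ , c₄)
    ... | no e₁  | _      | no e₃  | _      = ⊥-elim (inner-not-in-cut P Q e₁ e₃)
    ... | _      | no e₂  | _      | no e₄  = ⊥-elim (inner-not-in-cut (P ᵒᵖ) Q e₄ e₂)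
    ... | no e₁  | _      | _      | no e₄  =
      ⊥-elim (inner-not-in-cut Q P (corner-swap P Q e₁) (corner-swap (P ᵒᵖ) Q e₄))
    ... | _      | no e₂  | no e₃  | _      =
      ⊥-elim (inner-not-in-cut (Q ᵒᵖ) P (corner-swap P (Q ᵒᵖ) e₃) (corner-swap (P ᵒᵖ) (Q ᵒᵖ) e₂))

lemma1 : (n : ℕ) (G : Graph n) (k : ℕ) → 1 ≤ k → NonComplete G →
    Connectivity G k → MinDegreeAtLeast G ((3 * k) / 2) →
    (F : Subset n) → IsEnd G F →
    (S₁ : Subset n) → IsMinVertexCut G S₁ → Empty (F ∩ S₁)
lemma1 n G k _ non-complete (inj₁ (complete , _)) _ _ _ _ _ = ⊥-elim (non-complete complete)
lemma1 n G k _ _ (inj₂ ((S₀ , S₀-cut , ∣S₀∣≡k) , k≤cut)) δ≥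
       F F-end@((S , F-fragment@(S-min , _)) , _) S₁ S₁-min@(S₁-cut , _) (x , x∈F∩S₁) =
  crossed (fragment-separation F-fragment ∣ S-min ∣≡k) (cut-separation S₁-cut ∣ S₁-min ∣≡k)
  where
  open Separations G
  open Crossing k≤cut δ≥

  ∣_∣≡k : ∀ {T} → IsMinVertexCut G T → ∣ T ∣ ≡ k
  ∣ T-min ∣≡k = minimum-cut-size S₀-cut ∣S₀∣≡k k≤cut T-min

  x-inner : ∀ P Q {T} → (∀ {v} → part P v ≡ inner → v ∈ F) →
            IsFragmentTo G T (corner P Q) → part Q x ≡ inner
  x-inner P Q inner⊆F fragment =
    proj₂ (∈-corner⁻ P Q (end⊆corner P Q F-end inner⊆F fragment (proj₁ (x∈p∩q⁻ F S₁ x∈F∩S₁))))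

  crossed : Σ[ P ∈ Separation k ] (∀ {v} → part P v ≡ inner → v ∈ F) →
            Σ[ Q ∈ Separation k ] (∀ {v} → v ∈ S₁ → part Q v ≡ cut) → ⊥
  crossed (P , inner⊆F) (Q , S₁⊆cut) with crossing P Q | S₁⊆cut (proj₂ (x∈p∩q⁻ F S₁ x∈F∩S₁))
  ... | inj₁ (c , c′) | x-cut =
    inner≢cut (x-inner P Q inner⊆F (diagonal-fragment P Q c c′)) x-cut
  ... | inj₂ (c , c′) | x-cut =
    inner≢cut (x-inner P (Q ᵒᵖ) inner⊆F (diagonal-fragment P (Q ᵒᵖ) c (corner-mirror² (P ᵒᵖ) Q c′)))
              (cong mirror x-cut)
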